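{- Let $\phi$ and $\psi$ be IFG$_N$-formulas and $\mathfrak A$ a suitable structure with universe $A$. Then $\mathfrak A\models^+\phi\leftrightarrow_{/N}\psi$ if and only if $\|\phi\|_{\mathfrak A}=\|\psi\|_{\mathfrak A}\in\{0,1\}$, where $0=\langle\{\emptyset\},\mathcal P({}^NA)\rangle$ and $1=\langle\mathcal P({}^NA),\{\emptyset\}\rangle$.
   Context: Identify $N$ with $\{0,\dots,N-1\}$; ${}^NA$ is the set of valuations $\vec a=(a_0,\dots,a_{N-1})$; a team is a subset of ${}^NA$. For $J\subseteq N$, $\vec a\approx_J\vec b$ means they agree on $N\setminus J$. $V=V_1\cup_J V_2$ means $V_1\cup V_2=V$, $V_1\cap V_2=\emptyset$, and each $V_i$ is closed under $\approx_J$ within $V$. $f:V\to A$ is independent of $J$ if $f(\vec a)=f(\vec b)$ whenever $\vec a\approx_J\vec b$. $\vec a(n:b)$ is $\vec a$ with $n$th coordinate replaced by $b$; $V(n:f)=\{\vec a(n:f(\vec a)):\vec a\in V\}$; $W(n:A)=\{\vec a(n:b):\vec a\in W,b\in A\}$. IFG$_N$-formulas in variables $v_0,\dots,v_{N-1}$ are built from atomic first-order formulas by $\sim\phi$, $\phi\vee_{/J}\psi$ ($J\subseteq N$) and $(\exists v_n/J)\phi$. Abbreviations: $\phi\wedge_{/J}\psi:=\sim(\sim\phi\vee_{/J}\sim\psi)$, $\phi\to_{/J}\psi:=\sim\phi\vee_{/J}\psi$, $\phi\leftrightarrow_{/J}\psi:=(\phi\to_{/J}\psi)\wedge_{/J}(\psi\to_{/J}\phi)$;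 in $\leftrightarrow_{/N}$ the subscript is the full set $N=\{0,\dots,N-1\}$. For a structure $\mathfrak A$ with universe $A$ and teams $V,W$, $\mathfrak A\models^+\phi[V]$ and $\mathfrak A\models^-\phi[W]$ are defined recursively: atomic: every $\vec a\in V$ satisfies $\phi$ / no $\vec b\in W$ satisfies $\phi$; $\mathfrak A\models^\pm\sim\psi[V]$ iff $\mathfrak A\models^\mp\psi[V]$; $\mathfrak A\models^+\psi_1\vee_{/J}\psi_2[V]$ iff $\mathfrak A\models^+\psi_1[V_1]$ and $\mathfrak A\models^+\psi_2[V_2]$ for some $V=V_1\cup_JV_2$, and $\mathfrak A\models^-\psi_1\vee_{/J}\psi_2[W]$ iff $\mathfrak A\models^-\psi_i[W]$ for $i=1,2$; $\mathfrak A\models^+(\exists v_n/J)\psi[V]$ iff $\mathfrak A\models^+\psi[V(n:f)]$ for some $f:V\to A$ independent of $J$, and $\mathfrak A\models^-(\exists v_n/J)\psi[W]$ iff $\mathfrak A\models^-\psi[W(n:A)]$. $\mathfrak A\models^+\phi$ means $\mathfrak A\models^+\phi[{}^NA]$. The meaning is $\|\phi\|_{\mathfrak A}=\langle\{V:\mathfrak A\models^+\phi[V]\},\{W:\mathfrak A\models^-\phi[W]\}\rangle$. -}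

module Defs where

open import Data.Nat using (ℕ)
open import Data.Fin using (Fin; _≟_)
open import Data.Fin.Subset using (Subset; _∈_; _∉_) renaming (⊤ to FullSet)
open import Data.Product using (Σ; _×_; _,_)
open import Data.Sum using (_⊎_)
open import Data.Unit using (⊤)
open import Data.Empty using (⊥)
open import Relation.Nullary using (¬_; yes; no)
open import Relation.Binary.PropositionalEquality using (_≡_)
open import Function.Bundles using (_⇔_)
open import Level using (Lift; 0ℓ; suc)

Lift′ : Set → Set₁
Lift′ X = Lift (suc 0ℓ) X

record Signature : Set₁ where
  field
    FunSym   : Set
    funArity : FunSym → ℕ
    RelSym   : Set
    relArity : RelSym → ℕ

-- A structure for a signature. As usual in model theory the universe
-- is nonempty (witnessed by `point`).
record Structure (σ : Signature) : Set₁ where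
  open Signature σ
  field
    Carrier : Set
    point   : Carrier
    funI    : (f : FunSym) → (Fin (funArity f) → Carrier) → Carrier
    relI    : (r : RelSym) → (Fin (relArity r) → Carrier) → Set

module _ (σ : Signature) (N : ℕ) where
  open Signature σ

  data Term : Set where
    var : Fin N → Term
    app : (f : FunSym) → (Fin (funArity f) → Term) → Term

  data Atom : Set where
    _≐_  : Term → Term → Atom
    rel  : (r : RelSym) → (Fin (relArity r) → Term) → Atom

  data IFG : Set where
    atom : Atom → IFG
    ∼_   : IFG → IFG
    _∨/[_]_ : IFG → Subset N → IFG → IFG
    ∃/ : Fin N → Subset N → IFG → IFG

module _ {σ : Signature} {N : ℕ} where
  _∧/[_]_ : IFG σ N → Subset N → IFG σ N → IFG σ N
  φ ∧/[ J ] ψ = ∼ ((∼ φ) ∨/[ J ] (∼ ψ))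

  _→/[_]_ : IFG σ N → Subset N → IFG σ N → IFG σ N
  φ →/[ J ] ψ = (∼ φ) ∨/[ J ] ψ

  _↔/[_]_ : IFG σ N → Subset N → IFG σ N → IFG σ N
  φ ↔/[ J ] ψ = (φ →/[ J ] ψ) ∧/[ J ] (ψ →/[ J ] φ)


allN : {N : ℕ} → Subset N
allN = FullSet

module Semantics {σ : Signature} (𝔄 : Structure σ) (N : ℕ) where
  open Signature σ
  open Structure 𝔄

  Val : Set
  Val = Fin N → Carrier

  Team : Set₁
  Team = Val → Set

  FullTeam : Team
  FullTeam _ = ⊤

  EmptyTeam : Team → Set
  EmptyTeam V = ∀ a → ¬ V a

  evalT : Term σ N → Val → Carrier
  evalT (var i) a = a i
  evalT (app f ts) a = funI f (λ k → evalT (ts k) a)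

  holds : Atom σ N → Val → Set
  holds (t ≐ u) a = evalT t a ≡ evalT u a
  holds (rel r ts) a = relI r (λ k → evalT (ts k) a)

  _≈[_]_ : Val → Subset N → Val → Set
  a ≈[ J ] b = ∀ i → i ∉ J → a i ≡ b i

  Split : Subset N → Team → Team → Team → Set
  Split J V V₁ V₂ =
      (∀ a → V a → V₁ a ⊎ V₂ a)
    × (∀ a → V₁ a → V a)
    × (∀ a → V₂ a → V a)
    × (∀ a → V₁ a → V₂ a → ⊥)
    × (∀ a b → V a → V b → a ≈[ J ] b → V₁ a → V₁ b)
    × (∀ a b → V a → V b → a ≈[ J ] b → V₂ a → V₂ b)

  TeamFun : Team → Set
  TeamFun V = (a : Val) → V a → Carrier

  IndependentOf : Subset N → (V : Team) → TeamFun V → Set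
  IndependentOf J V f = ∀ a b (p : V a) (q : V b) → a ≈[ J ] b → f a p ≡ f b q

  update : Val → Fin N → Carrier → Val
  update a n x i with i ≟ n
  ... | yes _ = x
  ... | no  _ = a i

  _⟨_∶_⟩ : (V : Team) → Fin N → TeamFun V → Team
  (V ⟨ n ∶ f ⟩) b = Σ Val λ a → Σ (V a) λ p → ∀ i → b i ≡ update a n (f a p) i

  _⟨_∶A⟩ : Team → Fin N → Team
  (W ⟨ n ∶A⟩) b = Σ Val λ a → W a × Σ Carrier λ x → ∀ i → b i ≡ update a n x i

  mutual
    ⊨⁺_[_] : IFG σ N → Team → Set₁
    ⊨⁺ atom α [ V ] = Lift′ (∀ a → V a → holds α a)
    ⊨⁺ ∼ φ [ V ] = ⊨⁻ φ [ V ]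
    ⊨⁺ φ ∨/[ J ] ψ [ V ] =
      Σ Team λ V₁ → Σ Team λ V₂ → Lift′ (Split J V V₁ V₂) × (⊨⁺ φ [ V₁ ]) × (⊨⁺ ψ [ V₂ ])
    ⊨⁺ ∃/ n J φ [ V ] =
      Σ (TeamFun V) λ f → Lift′ (IndependentOf J V f) × (⊨⁺ φ [ V ⟨ n ∶ f ⟩ ])

    ⊨⁻_[_] : IFG σ N → Team → Set₁
    ⊨⁻ atom α [ W ] = Lift′ (∀ a → W a → ¬ holds α a)
    ⊨⁻ ∼ φ [ W ] = ⊨⁺ φ [ W ]
    ⊨⁻ φ ∨/[ J ] ψ [ W ] = (⊨⁻ φ [ W ]) × (⊨⁻ ψ [ W ])
    ⊨⁻ ∃/ n J φ [ W ] = ⊨⁻ φ [ W ⟨ n ∶A⟩ ]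

  ⊨⁺_ : IFG σ N → Set₁
  ⊨⁺ φ = ⊨⁺ φ [ FullTeam ]

  SameMeaning : IFG σ N → IFG σ N → Set₁
  SameMeaning φ ψ =
      (∀ V → (⊨⁺ φ [ V ]) ⇔ (⊨⁺ ψ [ V ]))
    × (∀ W → (⊨⁻ φ [ W ]) ⇔ (⊨⁻ ψ [ W ]))

  MeaningIsZero : IFG σ N → Set₁
  MeaningIsZero φ =
      (∀ V → (⊨⁺ φ [ V ]) ⇔ Lift′ (EmptyTeam V))
    × (∀ W → ⊨⁻ φ [ W ])

  MeaningIsOne : IFG σ N → Set₁
  MeaningIsOne φ =
      (∀ V → ⊨⁺ φ [ V ])
    × (∀ W → (⊨⁻ φ [ W ]) ⇔ Lift′ (EmptyTeam W))

-- The proof rests on three structural facts of team semantics, valid for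
-- every formula: satisfaction and falsification are downward closed, the
-- empty team both satisfies and falsifies every formula, and no inhabited
-- team both satisfies and falsifies a formula.  Together they show that a
-- formula falsified by the full team has meaning 0 and a formula satisfied
-- by the full team has meaning 1.  Next, a disjunction slashed by the full
-- index set N can only split an inhabited team trivially, so on such a team
-- it behaves like a classical disjunction.  Since ↔/N unfolds to a
-- conjunction of two such disjunctions, ⊨⁺ φ ↔/N ψ says exactly
-- "(φ false or ψ true) and (ψ false or φ true)" on the full team, and a
-- case analysis using consistency yields the theorem.
module Submission where

open import Defs
open import Data.Nat using (ℕ)
open import Data.Sum using (_⊎_; inj₁; inj₂)
open import Data.Product using (_×_; _,_; proj₁; proj₂)
open import Data.Empty using (⊥; ⊥-elim)
open import Data.Unit using (tt)
open import Data.Fin.Subset.Properties using (∈⊤)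
open import Function.Bundles using (_⇔_; mk⇔; Equivalence)
open import Function.Construct.Composition using (_⇔-∘_)
open import Function.Construct.Symmetry using (⇔-sym)
open import Level using (lift; lower)
open import Relation.Binary.PropositionalEquality using (refl)

module _ {σ : Signature} (𝔄 : Structure σ) (N : ℕ) where
  open Semantics 𝔄 N
  open Structure 𝔄
  open Equivalence using (to; from)

  _⊆_ : Team → Team → Set
  V′ ⊆ V = ∀ a → V′ a → V a

  NoTeam : Team
  NoTeam _ = ⊥

  -- Satisfaction and falsification are downward closed.  A split of V
  -- restricts to a split of V′, and V′(n:f) ⊆ V(n:f), V′(n:A) ⊆ V(n:A).
  mutual
    downward-closed⁺ : ∀ φ {V V′} → V′ ⊆ V → ⊨⁺ φ [ V ] → ⊨⁺ φ [ V′ ]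
    downward-closed⁺ (atom α) V′⊆V (lift h) = lift (λ a v → h a (V′⊆V a v))
    downward-closed⁺ (∼ φ) V′⊆V h = downward-closed⁻ φ V′⊆V h
    downward-closed⁺ (φ ∨/[ J ] ψ) {V} {V′} V′⊆V
      (V₁ , V₂ , lift (cover , _ , _ , disjoint , closed₁ , closed₂) , h₁ , h₂) =
      V′₁ , V′₂ ,
      lift ( (λ a v′ → restrict a v′ (cover a (V′⊆V a v′)))
           , (λ _ → proj₁) , (λ _ → proj₁)
           , (λ a x y → disjoint a (proj₂ x) (proj₂ y))
           , (λ a b va vb a≈b x → vb , closed₁ a b (V′⊆V a va) (V′⊆V b vb) a≈b (proj₂ x))
           , (λ a b va vb a≈b x → vb , closed₂ a b (V′⊆V a va) (V′⊆V b vb) a≈b (proj₂ x)) ) ,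
      downward-closed⁺ φ (λ _ → proj₂) h₁ , downward-closed⁺ ψ (λ _ → proj₂) h₂
      where
        V′₁ V′₂ : Team
        V′₁ a = V′ a × V₁ a
        V′₂ a = V′ a × V₂ a

        restrict : ∀ a → V′ a → V₁ a ⊎ V₂ a → V′₁ a ⊎ V′₂ a
        restrict a v′ (inj₁ x) = inj₁ (v′ , x)
        restrict a v′ (inj₂ x) = inj₂ (v′ , x)
    downward-closed⁺ (∃/ n J φ) V′⊆V (f , lift independent , h) =
      (λ a v′ → f a (V′⊆V a v′)) ,
      lift (λ a b p q → independent a b (V′⊆V a p) (V′⊆V b q)) ,
      downward-closed⁺ φ (λ _ (a , v′ , eq) → a , V′⊆V a v′ , eq) h

    downward-closed⁻ : ∀ φ {W W′} → W′ ⊆ W → ⊨⁻ φ [ W ] → ⊨⁻ φ [ W′ ]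
    downward-closed⁻ (atom α) W′⊆W (lift g) = lift (λ a w → g a (W′⊆W a w))
    downward-closed⁻ (∼ φ) W′⊆W g = downward-closed⁺ φ W′⊆W g
    downward-closed⁻ (φ ∨/[ J ] ψ) W′⊆W (g₁ , g₂) =
      downward-closed⁻ φ W′⊆W g₁ , downward-closed⁻ ψ W′⊆W g₂
    downward-closed⁻ (∃/ n J φ) W′⊆W g =
      downward-closed⁻ φ (λ _ (a , w′ , rest) → a , W′⊆W a w′ , rest) g

  -- The empty team splits as itself twice, and every function on it is
  -- independent, so it satisfies and falsifies every formula.
  mutual
    empty-satisfies : ∀ φ {E} → EmptyTeam E → ⊨⁺ φ [ E ]
    empty-satisfies (atom α) empty = lift (λ a e → ⊥-elim (empty a e))
    empty-satisfies (∼ φ) empty = empty-falsifies φ empty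
    empty-satisfies (φ ∨/[ J ] ψ) {E} empty =
      E , E ,
      lift ( (λ a e → ⊥-elim (empty a e)) , (λ _ e → e) , (λ _ e → e)
           , (λ a e _ → empty a e)
           , (λ a _ e _ _ _ → ⊥-elim (empty a e))
           , (λ a _ e _ _ _ → ⊥-elim (empty a e)) ) ,
      empty-satisfies φ empty , empty-satisfies ψ empty
    empty-satisfies (∃/ n J φ) empty =
      (λ a e → ⊥-elim (empty a e)) ,
      lift (λ a _ e _ _ → ⊥-elim (empty a e)) ,
      empty-satisfies φ (λ _ (a , e , _) → empty a e)

    empty-falsifies : ∀ φ {E} → EmptyTeam E → ⊨⁻ φ [ E ]
    empty-falsifies (atom α) empty = lift (λ a e → ⊥-elim (empty a e))
    empty-falsifies (∼ φ) empty = empty-satisfies φ empty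
    empty-falsifies (φ ∨/[ J ] ψ) empty =
      empty-falsifies φ empty , empty-falsifies ψ empty
    empty-falsifies (∃/ n J φ) empty =
      empty-falsifies φ (λ _ (a , e , _) → empty a e)

  -- For a disjunction, a lies in one half of the split; for
  -- (∃ v_n/J), the witness a(n : f a) lies in both V(n:f) and V(n:A).
  consistent : ∀ φ {V} a → V a → ⊨⁺ φ [ V ] → ⊨⁻ φ [ V ] → ⊥
  consistent (atom α) a v (lift h) (lift g) = g a v (h a v)
  consistent (∼ φ) a v h g = consistent φ a v g h
  consistent (φ ∨/[ J ] ψ) a v (V₁ , V₂ , lift (cover , V₁⊆V , V₂⊆V , _) , h₁ , h₂) (g₁ , g₂)
    with cover a v
  ... | inj₁ a∈V₁ = consistent φ a a∈V₁ h₁ (downward-closed⁻ φ V₁⊆V g₁)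
  ... | inj₂ a∈V₂ = consistent ψ a a∈V₂ h₂ (downward-closed⁻ ψ V₂⊆V g₂)
  consistent (∃/ n J φ) a v (f , _ , h) g =
    consistent φ (update a n (f a v)) (a , v , λ _ → refl) h
      (downward-closed⁻ φ (λ _ (b , w , eq) → b , w , f b w , eq) g)

  all-related : ∀ a b → a ≈[ allN ] b
  all-related _ _ i i∉N = ⊥-elim (i∉N ∈⊤)

  inhabited-split-trivial : ∀ {V V₁ V₂} a → V a → Split allN V V₁ V₂ → V ⊆ V₁ ⊎ V ⊆ V₂
  inhabited-split-trivial a v (cover , _ , _ , _ , closed₁ , closed₂) with cover a v
  ... | inj₁ a∈V₁ = inj₁ (λ b w → closed₁ a b v w (all-related a b) a∈V₁)
  ... | inj₂ a∈V₂ = inj₂ (λ b w → closed₂ a b v w (all-related a b) a∈V₂)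

  split-left : ∀ J V → Split J V V NoTeam
  split-left J V =
    (λ _ → inj₁) , (λ _ v → v) , (λ _ ()) , (λ _ _ ()) , (λ _ _ _ vb _ _ → vb) , (λ _ _ _ _ _ ())

  split-right : ∀ J V → Split J V NoTeam V
  split-right J V =
    (λ _ → inj₂) , (λ _ ()) , (λ _ v → v) , (λ _ ()) , (λ _ _ _ _ _ ()) , (λ _ _ _ vb _ _ → vb)

  ∨/N-classical : ∀ φ ψ {V} a → V a →
    ⊨⁺ (φ ∨/[ allN ] ψ) [ V ] ⇔ (⊨⁺ φ [ V ] ⊎ ⊨⁺ ψ [ V ])
  ∨/N-classical φ ψ {V} a v = mk⇔ decide combine
    where
      decide : ⊨⁺ (φ ∨/[ allN ] ψ) [ V ] → ⊨⁺ φ [ V ] ⊎ ⊨⁺ ψ [ V ]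
      decide (V₁ , V₂ , lift split , h₁ , h₂) with inhabited-split-trivial a v split
      ... | inj₁ V⊆V₁ = inj₁ (downward-closed⁺ φ V⊆V₁ h₁)
      ... | inj₂ V⊆V₂ = inj₂ (downward-closed⁺ ψ V⊆V₂ h₂)

      combine : ⊨⁺ φ [ V ] ⊎ ⊨⁺ ψ [ V ] → ⊨⁺ (φ ∨/[ allN ] ψ) [ V ]
      combine (inj₁ h) =
        V , NoTeam , lift (split-left allN V) , h , empty-satisfies ψ (λ _ ())
      combine (inj₂ h) =
        NoTeam , V , lift (split-right allN V) , empty-satisfies φ (λ _ ()) , h

  -- The full team is inhabited since the universe is nonempty.
  constant-valuation : Val
  constant-valuation _ = point

  full-contains : ∀ {V} → V ⊆ FullTeam
  full-contains _ _ = tt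

  -- Since φ ∧/J ψ is ∼(∼φ ∨/J ∼ψ), its satisfaction is literally the pair of
  -- satisfactions; so ↔/N on the full team is a pair of classical implications.
  biconditional-classical : ∀ φ ψ →
    ⊨⁺ (φ ↔/[ allN ] ψ) ⇔
      ((⊨⁻ φ [ FullTeam ] ⊎ ⊨⁺ ψ [ FullTeam ]) × (⊨⁻ ψ [ FullTeam ] ⊎ ⊨⁺ φ [ FullTeam ]))
  biconditional-classical φ ψ =
    mk⇔ (λ (φ→ψ , ψ→φ) → to (imp φ ψ) φ→ψ , to (imp ψ φ) ψ→φ)
        (λ (φ→ψ , ψ→φ) → from (imp φ ψ) φ→ψ , from (imp ψ φ) ψ→φ)
    where
      imp : ∀ θ χ → ⊨⁺ (θ →/[ allN ] χ) ⇔ (⊨⁻ θ [ FullTeam ] ⊎ ⊨⁺ χ [ FullTeam ])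
      imp θ χ = ∨/N-classical (∼ θ) χ constant-valuation tt

  -- A formula falsified by the full team has meaning 0: by downward closure it
  -- is falsified by every team, and by consistency only ∅ satisfies it.
  meaning-zero : ∀ φ → ⊨⁻ φ [ FullTeam ] → MeaningIsZero φ
  meaning-zero φ g =
    (λ V → mk⇔ (λ h → lift (λ a v → consistent φ a v h (falsified V)))
               (λ empty → empty-satisfies φ (lower empty))) ,
    falsified
    where
      falsified : ∀ W → ⊨⁻ φ [ W ]
      falsified W = downward-closed⁻ φ full-contains g

  meaning-one : ∀ φ → ⊨⁺ φ [ FullTeam ] → MeaningIsOne φ
  meaning-one φ h =
    satisfied ,
    (λ W → mk⇔ (λ g → lift (λ a w → consistent φ a w (satisfied W) g))
               (λ empty → empty-falsifies φ (lower empty)))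
    where
      satisfied : ∀ V → ⊨⁺ φ [ V ]
      satisfied V = downward-closed⁺ φ full-contains h

  same-zero : ∀ φ ψ → MeaningIsZero φ → MeaningIsZero ψ → SameMeaning φ ψ
  same-zero φ ψ (sat-φ , fals-φ) (sat-ψ , fals-ψ) =
    (λ V → ⇔-sym (sat-ψ V) ⇔-∘ sat-φ V) ,
    (λ W → mk⇔ (λ _ → fals-ψ W) (λ _ → fals-φ W))

  same-one : ∀ φ ψ → MeaningIsOne φ → MeaningIsOne ψ → SameMeaning φ ψ
  same-one φ ψ (sat-φ , fals-φ) (sat-ψ , fals-ψ) =
    (λ V → mk⇔ (λ _ → sat-ψ V) (λ _ → sat-φ V)) ,
    (λ W → ⇔-sym (fals-ψ W) ⇔-∘ fals-φ W)

  biconditional-characterisation : ∀ φ ψ →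
    (⊨⁺ (φ ↔/[ allN ] ψ)) ⇔ (SameMeaning φ ψ × (MeaningIsZero φ ⊎ MeaningIsOne φ))
  biconditional-characterisation φ ψ =
    mk⇔ (λ h → fromCases (to (biconditional-classical φ ψ) h))
        (λ m → from (biconditional-classical φ ψ) (toCases m))
    where
      inconsistent : ∀ θ → ⊨⁺ θ [ FullTeam ] → ⊨⁻ θ [ FullTeam ] → ⊥
      inconsistent θ = consistent θ constant-valuation tt

      fromCases : (⊨⁻ φ [ FullTeam ] ⊎ ⊨⁺ ψ [ FullTeam ]) × (⊨⁻ ψ [ FullTeam ] ⊎ ⊨⁺ φ [ FullTeam ]) →
        SameMeaning φ ψ × (MeaningIsZero φ ⊎ MeaningIsOne φ)
      fromCases (inj₁ φ-false , inj₁ ψ-false) =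
        same-zero φ ψ (meaning-zero φ φ-false) (meaning-zero ψ ψ-false) , inj₁ (meaning-zero φ φ-false)
      fromCases (inj₂ ψ-true , inj₂ φ-true) =
        same-one φ ψ (meaning-one φ φ-true) (meaning-one ψ ψ-true) , inj₂ (meaning-one φ φ-true)
      fromCases (inj₁ φ-false , inj₂ φ-true) = ⊥-elim (inconsistent φ φ-true φ-false)
      fromCases (inj₂ ψ-true , inj₁ ψ-false) = ⊥-elim (inconsistent ψ ψ-true ψ-false)

      toCases : SameMeaning φ ψ × (MeaningIsZero φ ⊎ MeaningIsOne φ) →
        (⊨⁻ φ [ FullTeam ] ⊎ ⊨⁺ ψ [ FullTeam ]) × (⊨⁻ ψ [ FullTeam ] ⊎ ⊨⁺ φ [ FullTeam ])
      toCases ((_ , same⁻) , inj₁ (_ , φ-false)) =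
        inj₁ (φ-false FullTeam) , inj₁ (to (same⁻ FullTeam) (φ-false FullTeam))
      toCases ((same⁺ , _) , inj₂ (φ-true , _)) =
        inj₂ (to (same⁺ FullTeam) (φ-true FullTeam)) , inj₂ (φ-true FullTeam)

mainTheorem9 : {σ : Signature} (𝔄 : Structure σ) (N : ℕ) (φ ψ : IFG σ N) →
    let open Semantics 𝔄 N in
    (⊨⁺ (φ ↔/[ allN ] ψ)) ⇔ (SameMeaning φ ψ × (MeaningIsZero φ ⊎ MeaningIsOne φ))
mainTheorem9 𝔄 N = biconditional-characterisation 𝔄 N
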